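{- Let $n$ be a positive integer and let $C_{B_n}$ be the number of permutations in $B_n$ having an $n$-crossing. Then $C_{B_n}=2$ if $n\le 2$, and $C_{B_n}=1$ otherwise.
   Context: For a positive integer $n$, $[n]=\{1,\dots,n\}$ and $[-n,n]=\{ -n,\dots,-1,1,\dots,n\}$ with the natural order of $\mathbb{Z}$. $B_n$ is the set of sequences $\sigma=(\sigma(1),\dots,\sigma(n))$ of integers with $\{|\sigma(1)|,\dots,|\sigma(n)|\}=[n]$, identified with a permutation of $[-n,n]$ via $\sigma(-i)=-\sigma(i)$. A set $\{a_1,\dots,a_k\}$ of $k$ integers in $[n]$ is a $k$-crossing of $\sigma$ if $a_1<\dots<a_k\le\sigma(a_1)<\dots<\sigma(a_k)$, or $-a_1<a_2<\dots<a_k\le-\sigma(a_1)<\sigma(a_2)<\dots<\sigma(a_k)$, or $\sigma(a_k)<\sigma(a_{k-1})<\dots<\sigma(a_1)<a_k<a_{k-1}<\dots<a_1$. An $n$-crossing of $\sigma\in B_n$ is thus a $k$-crossing with $k=n$. -}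

module Defs where

open import Data.Nat using (ℕ; suc; _≤_)
open import Data.Integer using (ℤ; +_; -_; ∣_∣) renaming (_<_ to _<ℤ_; _≤_ to _≤ℤ_; _>_ to _>ℤ_)
open import Data.Fin using (Fin; toℕ)
open import Data.Vec using (Vec; lookup)
open import Data.List using (List; []; _∷_; map; length)
open import Data.List.Relation.Unary.Linked using (Linked)
open import Data.List.Relation.Unary.Unique.Propositional using (Unique)
open import Data.List.Membership.Propositional using (_∈_)
open import Data.Product using (Σ; ∃; _×_)
open import Data.Sum using (_⊎_)
open import Function.Bundles using (_⇔_)
open import Relation.Binary.PropositionalEquality using (_≡_)

-- A signed permutation σ ∈ B_n is stored as the sequence (σ(1),…,σ(n)) : Vec ℤ n.
-- Position i : Fin n stands for the integer toℕ i + 1 ∈ [n].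

ι : {n : ℕ} → Fin n → ℤ
ι i = + suc (toℕ i)

app : {n : ℕ} → Vec ℤ n → Fin n → ℤ
app σ i = lookup σ i

InB : (n : ℕ) → Vec ℤ n → Set
InB n σ = (∀ (i : Fin n) → 1 ≤ ∣ app σ i ∣ × ∣ app σ i ∣ ≤ n)
        × (∀ (j : Fin n) → ∃ λ (i : Fin n) → ∣ app σ i ∣ ≡ suc (toℕ j))

lastℤ : ℤ → List ℤ → ℤ
lastℤ x [] = x
lastℤ x (y ∷ ys) = lastℤ y ys

LtLeChain : ℤ → List ℤ → ℤ → List ℤ → Set
LtLeChain x xs y ys = Linked _<ℤ_ (x ∷ xs) × lastℤ x xs ≤ℤ y × Linked _<ℤ_ (y ∷ ys)

-- For an enumeration (a₁,…,aₖ) = a ∷ rest of elements of [n]: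
-- (1)  a₁ < … < aₖ ≤ σ(a₁) < … < σ(aₖ)
Cond1 : {n : ℕ} → Vec ℤ n → Fin n → List (Fin n) → Set
Cond1 σ a rest = LtLeChain (ι a) (map ι rest) (app σ a) (map (app σ) rest)

Cond2 : {n : ℕ} → Vec ℤ n → Fin n → List (Fin n) → Set
Cond2 σ a rest = LtLeChain (- ι a) (map ι rest) (- app σ a) (map (app σ) rest)

Cond3 : {n : ℕ} → Vec ℤ n → Fin n → List (Fin n) → Set
Cond3 σ a rest = Linked _>ℤ_ (app σ a ∷ map (app σ) rest)
               × app σ a <ℤ lastℤ (ι a) (map ι rest)
               × Linked _>ℤ_ (ι a ∷ map ι rest)

-- {a₁,…,aₖ} ⊆ [n] is a k-crossing of σ: the set has k (distinct) elements and
-- admits an enumeration satisfying one of the three chains.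
-- (k = 0 never occurs below since n ≥ 1.)
HasCrossing : (n k : ℕ) → Vec ℤ n → Set
HasCrossing n k σ =
  Σ (Fin n) λ a → Σ (List (Fin n)) λ rest →
    Unique (a ∷ rest) × length (a ∷ rest) ≡ k
    × (Cond1 σ a rest ⊎ Cond2 σ a rest ⊎ Cond3 σ a rest)

HasCount : {A : Set} → (A → Set) → ℕ → Set
HasCount {A} P c = Σ (List A) λ L → Unique L × (∀ x → (x ∈ L) ⇔ P x) × length L ≡ c

CB≡ : (n c : ℕ) → Set
CB≡ n c = HasCount (λ (σ : Vec ℤ n) → InB n σ × HasCrossing n n σ) c

-- An n-crossing of σ ∈ Bₙ has n elements, so it enumerates all of [n], and each of its three shapes
-- is a pair of strictly monotone chains of length n inside [−n, n].  A chain of length ℓ + 1 spreads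
-- over at least ℓ, so shape (1) gives σ(a₂) > σ(a₁) ≥ aₙ ≥ n and shape (2) gives 2(n − 1) ≤ σ(aₙ) ≤ n:
-- these force n ≤ 1 and n ≤ 2.  In shape (3), aₙ < … < a₁ lists [n] while σ(aₙ) < … < σ(a₁) < aₙ = 1
-- are n values in [−n, −1], hence σ(i) = i − n − 1.  For n ≤ 2 the remaining cases are the extra
-- permutations (1) ∈ B₁ and (2, −1) ∈ B₂.

module Submission where

open import Defs
open import Data.Nat as ℕ using (ℕ; zero; suc; z≤n; s≤s)
import Data.Nat.Properties as ℕ
open import Data.Integer
  using (ℤ; +_; -[1+_]; -_; ∣_∣; _+_; _⊖_; _≤_; _<_; _>_; -1ℤ; +≤+; -≤-; -≤+; +<+; -<+)
  renaming (suc to sucℤ)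
open import Data.Integer.Properties
  using ( ≤-refl; ≤-reflexive; ≤-trans; ≤-antisym; <-irrefl; <-≤-trans; neg-≤-pos; neg-involutive
        ; +-identityʳ; +-assoc; +-comm; +-monoˡ-≤; +-monoˡ-<; ⊖-monoˡ-<; ∣⊖∣-<; [1+m]⊖[1+n]≡m⊖n
        ; -m+n≡n⊖m; i<j⇒suc[i]≤j; i<j⇒i≤pred[j]; pred-suc; drop‿+≤+; module ≤-Reasoning)
open import Data.Fin as Fin using (Fin; toℕ; opposite)
open import Data.Fin.Properties
  using (toℕ<n; toℕ-injective; toℕ-fromℕ; toℕ-inject₁; opposite-prop; opposite-involutive)
open import Data.Vec using (Vec; []; _∷_)
import Data.Vec as Vec
open import Data.Vec.Properties using (tabulate∘lookup; tabulate-cong; lookup∘tabulate)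
open import Data.List using (List; []; _∷_; map; length; downFrom; tabulate)
open import Data.List.Properties
  using (length-tabulate; map-∘; map-cong; map-injective; map-tabulate; ∷-injectiveˡ; ∷-injectiveʳ)
  renaming (tabulate-cong to List-tabulate-cong)
open import Data.List.Relation.Unary.Linked using (Linked; []; [-]; _∷_)
open import Data.List.Relation.Unary.AllPairs using ([]; _∷_)
open import Data.List.Relation.Unary.All using ([]; _∷_)
open import Data.List.Relation.Unary.Any using (here; there)
import Data.List.Relation.Unary.Unique.Propositional.Properties as Unique
open import Data.List.Membership.Propositional using (_∈_)
open import Data.List.Membership.Propositional.Properties using (∈-map⁻; ∈-downFrom⁺)
open import Data.Product using (∃; _×_; _,_; proj₁; proj₂; uncurry)
open import Data.Sum as Sum using (_⊎_; inj₁; inj₂; [_,_]′)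
open import Data.Empty using (⊥-elim)
open import Function using (_∘_)
open import Function.Bundles using (mk⇔)
open import Relation.Nullary using (contradiction)
open import Relation.Binary.PropositionalEquality
  using (_≡_; _≢_; refl; sym; trans; cong; cong₂; subst; module ≡-Reasoning)

private
  variable
    A B : Set

i+[1+n]≡suc[i+n] : ∀ i n → i + + suc n ≡ sucℤ (i + + n)
i+[1+n]≡suc[i+n] i n = begin
  i + (+ 1 + + n)   ≡⟨ +-assoc i (+ 1) (+ n) ⟨
  i + + 1 + + n     ≡⟨ cong (_+ + n) (+-comm i (+ 1)) ⟩
  + 1 + i + + n     ≡⟨ +-assoc (+ 1) i (+ n) ⟩
  + 1 + (i + + n)   ∎
  where open ≡-Reasoning

i<suc[j]⇒i≤j : ∀ {i j} → i < sucℤ j → i ≤ j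
i<suc[j]⇒i≤j {i} {j} i<suc[j] = subst (i ≤_) (pred-suc j) (i<j⇒i≤pred[j] i<suc[j])

m⊖1+m≡-1 : ∀ m → m ⊖ suc m ≡ -1ℤ
m⊖1+m≡-1 zero    = refl
m⊖1+m≡-1 (suc m) = trans ([1+m]⊖[1+n]≡m⊖n m (suc m)) (m⊖1+m≡-1 m)

∣i∣≤n⇒i≤n : ∀ {i n} → ∣ i ∣ ℕ.≤ n → i ≤ + n
∣i∣≤n⇒i≤n {+ _}      m≤n = +≤+ m≤n
∣i∣≤n⇒i≤n { -[1+ _ ]} _  = -≤+

∣i∣≤n⇒-n≤i : ∀ {i n} → ∣ i ∣ ℕ.≤ n → - + n ≤ i
∣i∣≤n⇒-n≤i {+ _}                  _         = neg-≤-pos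
∣i∣≤n⇒-n≤i { -[1+ _ ]} {suc _} (s≤s m≤n) = -≤- m≤n

i<1⇒1≤∣i∣⇒i≤-1 : ∀ {i} → i < + 1 → 1 ℕ.≤ ∣ i ∣ → i ≤ -1ℤ
i<1⇒1≤∣i∣⇒i≤-1 {+ zero}    _               ()
i<1⇒1≤∣i∣⇒i≤-1 {+ suc _}   (+<+ (s≤s ())) _
i<1⇒1≤∣i∣⇒i≤-1 { -[1+ _ ]} _               _ = -≤- z≤n

lastℤ-map⁺ : (P : ℤ → Set) (f : A → ℤ) → (∀ a → P (f a)) →
             ∀ a as → P (lastℤ (f a) (map f as))
lastℤ-map⁺ P f Pf a []        = Pf a
lastℤ-map⁺ P f Pf _ (a ∷ as) = lastℤ-map⁺ P f Pf a as

lastℤ-downFrom : ∀ (f : ℕ → ℤ) k {x xs} →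
                 x ∷ xs ≡ map f (downFrom (suc k)) → lastℤ x xs ≡ f 0
lastℤ-downFrom f zero    refl = refl
lastℤ-downFrom f (suc k) refl = lastℤ-downFrom f k refl

linked<⇒x+length≤lastℤ : ∀ (f : A → ℤ) {x} as → Linked _<_ (x ∷ map f as) →
                         x + + length as ≤ lastℤ x (map f as)
linked<⇒x+length≤lastℤ f {x} []       _             = ≤-reflexive (+-identityʳ x)
linked<⇒x+length≤lastℤ f {x} (a ∷ as) (x<fa ∷ fas) = begin
  x + + suc (length as)     ≡⟨ i+[1+n]≡suc[i+n] x (length as) ⟩
  sucℤ (x + + length as)    ≤⟨ i<j⇒suc[i]≤j (+-monoˡ-< (+ length as) x<fa) ⟩
  f a + + length as         ≤⟨ linked<⇒x+length≤lastℤ f as fas ⟩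
  lastℤ (f a) (map f as)    ∎
  where open ≤-Reasoning

linked>-squeezed⇒downFrom : ∀ lo (f : A → ℤ) {x} as → Linked _>_ (x ∷ map f as) →
                            lo ≤ lastℤ x (map f as) → x ≤ lo + + length as →
                            x ∷ map f as ≡ map (λ m → lo + + m) (downFrom (suc (length as)))
linked>-squeezed⇒downFrom lo f {x} [] _ lo≤x x≤lo+0 =
  cong (_∷ []) (≤-antisym x≤lo+0 (≤-trans (≤-reflexive (+-identityʳ lo)) lo≤x))
linked>-squeezed⇒downFrom lo f {x} (a ∷ as) (fa<x ∷ fas) lo≤last x≤lo+1+ℓ =
  cong₂ _∷_ x≡lo+1+ℓ tail≡
  where
  ℓ = length as
  x≤suc[lo+ℓ] : x ≤ sucℤ (lo + + ℓ)
  x≤suc[lo+ℓ] = subst (x ≤_) (i+[1+n]≡suc[i+n] lo ℓ) x≤lo+1+ℓ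
  tail≡ : f a ∷ map f as ≡ map (λ m → lo + + m) (downFrom (suc ℓ))
  tail≡ = linked>-squeezed⇒downFrom lo f as fas lo≤last
            (i<suc[j]⇒i≤j (<-≤-trans fa<x x≤suc[lo+ℓ]))
  x≡lo+1+ℓ : x ≡ lo + + suc ℓ
  x≡lo+1+ℓ = ≤-antisym x≤lo+1+ℓ (begin
    lo + + suc ℓ        ≡⟨ i+[1+n]≡suc[i+n] lo ℓ ⟩
    sucℤ (lo + + ℓ)     ≡⟨ cong sucℤ (∷-injectiveˡ tail≡) ⟨
    sucℤ (f a)          ≤⟨ i<j⇒suc[i]≤j fa<x ⟩
    x                   ∎)
    where open ≤-Reasoning

linked>-map-downFrom : (f : ℕ → ℤ) → (∀ m → f m < f (suc m)) →
                       ∀ k → Linked _>_ (map f (downFrom k))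
linked>-map-downFrom f f-incr zero          = []
linked>-map-downFrom f f-incr (suc zero)    = [-]
linked>-map-downFrom f f-incr (suc (suc k)) = f-incr k ∷ linked>-map-downFrom f f-incr (suc k)

map-≡⇒∈⇒≡ : ∀ {f g : A → B} {xs x} → map f xs ≡ map g xs → x ∈ xs → f x ≡ g x
map-≡⇒∈⇒≡ {xs = _ ∷ _} eq (here refl) = ∷-injectiveˡ eq
map-≡⇒∈⇒≡ {xs = _ ∷ _} eq (there x∈) = map-≡⇒∈⇒≡ (∷-injectiveʳ eq) x∈

toℕ≡downFrom⇒∈ : ∀ {n} {xs : List (Fin n)} → map toℕ xs ≡ downFrom n → ∀ i → i ∈ xs
toℕ≡downFrom⇒∈ {xs = xs} eq i
  with j , j∈xs , toℕi≡toℕj ← ∈-map⁻ toℕ (subst (toℕ i ∈_) (sym eq) (∈-downFrom⁺ (toℕ<n i)))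
  = subst (_∈ xs) (sym (toℕ-injective toℕi≡toℕj)) j∈xs

map-toℕ-tabulate-opposite : ∀ n → map toℕ (tabulate (opposite {n})) ≡ downFrom n
map-toℕ-tabulate-opposite zero    = refl
map-toℕ-tabulate-opposite (suc n) = cong₂ _∷_ (toℕ-fromℕ n) (begin
  map toℕ (tabulate (Fin.inject₁ ∘ opposite))   ≡⟨ map-tabulate _ toℕ ⟩
  tabulate (toℕ ∘ Fin.inject₁ ∘ opposite)       ≡⟨ List-tabulate-cong (toℕ-inject₁ ∘ opposite) ⟩
  tabulate (toℕ ∘ opposite)                     ≡⟨ map-tabulate opposite toℕ ⟨
  map toℕ (tabulate opposite)                   ≡⟨ map-toℕ-tabulate-opposite n ⟩
  downFrom n                                    ∎)
  where open ≡-Reasoning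

ι≥1 : ∀ {n} (i : Fin n) → + 1 ≤ ι i
ι≥1 i = +≤+ (s≤s z≤n)

-- σ(i) = i − n − 1, i.e. σ = (−n, −n+1, …, −1).
allNegative : (n : ℕ) → Vec ℤ n
allNegative n = Vec.tabulate (λ i → toℕ i ⊖ n)

app-allNegative : ∀ n i → app (allNegative n) i ≡ toℕ i ⊖ n
app-allNegative n = lookup∘tabulate (λ i → toℕ i ⊖ n)

allNegative-∈B : ∀ n → InB n (allNegative n)
allNegative-∈B n = bounds , preimage
  where
  open ≡-Reasoning
  ∣app∣≡n∸i : ∀ i → ∣ app (allNegative n) i ∣ ≡ n ℕ.∸ toℕ i
  ∣app∣≡n∸i i = trans (cong ∣_∣ (app-allNegative n i)) (∣⊖∣-< (toℕ<n i))
  bounds : ∀ i → 1 ℕ.≤ ∣ app (allNegative n) i ∣ × ∣ app (allNegative n) i ∣ ℕ.≤ n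
  bounds i rewrite ∣app∣≡n∸i i = ℕ.m<n⇒0<n∸m (toℕ<n i) , ℕ.m∸n≤m n (toℕ i)
  preimage : ∀ j → ∃ λ i → ∣ app (allNegative n) i ∣ ≡ suc (toℕ j)
  preimage j = opposite j , (begin
    ∣ app (allNegative n) (opposite j) ∣  ≡⟨ ∣app∣≡n∸i (opposite j) ⟩
    n ℕ.∸ toℕ (opposite j)               ≡⟨ cong (n ℕ.∸_) (opposite-prop j) ⟩
    n ℕ.∸ (n ℕ.∸ suc (toℕ j))            ≡⟨ ℕ.m∸[m∸n]≡n (toℕ<n j) ⟩
    suc (toℕ j)                           ∎)

allNegative-crossing : ∀ r → HasCrossing (suc r) (suc r) (allNegative (suc r))
allNegative-crossing r =
  a , rest , Unique.tabulate⁺ opposite-injective , length-tabulate opposite ,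
  inj₂ (inj₂ (σ-chain , σa<1 , ι-chain))
  where
  n = suc r
  a : Fin n
  a = opposite Fin.zero
  rest : List (Fin n)
  rest = tabulate (opposite ∘ Fin.suc)
  opposite-injective : ∀ {i j : Fin n} → opposite i ≡ opposite j → i ≡ j
  opposite-injective {i} {j} eq =
    trans (sym (opposite-involutive i)) (trans (cong opposite eq) (opposite-involutive j))
  map-via-toℕ : (f : ℕ → ℤ) {g : Fin n → ℤ} → (∀ i → g i ≡ f (toℕ i)) →
                map g (a ∷ rest) ≡ map f (downFrom n)
  map-via-toℕ f {g} g≗f∘toℕ = begin
    map g (a ∷ rest)            ≡⟨ map-cong g≗f∘toℕ (a ∷ rest) ⟩
    map (f ∘ toℕ) (a ∷ rest)    ≡⟨ map-∘ (a ∷ rest) ⟩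
    map f (map toℕ (a ∷ rest))  ≡⟨ cong (map f) (map-toℕ-tabulate-opposite n) ⟩
    map f (downFrom n)          ∎
    where open ≡-Reasoning
  σ-chain : Linked _>_ (map (app (allNegative n)) (a ∷ rest))
  σ-chain = subst (Linked _>_) (sym (map-via-toℕ (_⊖ n) (app-allNegative n)))
                  (linked>-map-downFrom (_⊖ n) (λ m → ⊖-monoˡ-< n (ℕ.n<1+n m)) n)
  ι-chain : Linked _>_ (map ι (a ∷ rest))
  ι-chain = subst (Linked _>_) (sym (map-via-toℕ (λ m → + suc m) (λ _ → refl)))
                  (linked>-map-downFrom (λ m → + suc m) (λ m → +<+ (ℕ.n<1+n (suc m))) n)
  σa<1 : app (allNegative n) a < lastℤ (ι a) (map ι rest)
  σa<1 = begin-strict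
    app (allNegative n) a         ≡⟨ app-allNegative n a ⟩
    toℕ a ⊖ n                     ≡⟨ cong (_⊖ n) (toℕ-fromℕ r) ⟩
    r ⊖ n                         ≡⟨ m⊖1+m≡-1 r ⟩
    -1ℤ                           <⟨ -<+ ⟩
    + 1                           ≤⟨ lastℤ-map⁺ (+ 1 ≤_) ι ι≥1 a rest ⟩
    lastℤ (ι a) (map ι rest)      ∎
    where open ≤-Reasoning

module _ {n : ℕ} (σ : Vec ℤ n) (σ∈B : InB n σ) where

  app≤n : ∀ i → app σ i ≤ + n
  app≤n i = ∣i∣≤n⇒i≤n (proj₂ (proj₁ σ∈B i))

  app≥-n : ∀ i → - + n ≤ app σ i
  app≥-n i = ∣i∣≤n⇒-n≤i (proj₂ (proj₁ σ∈B i))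

  cond1⇒n≤1 : ∀ a rest → length (a ∷ rest) ≡ n → Cond1 σ a rest → n ℕ.≤ 1
  cond1⇒n≤1 _ []       len _ = ℕ.≤-reflexive (sym len)
  cond1⇒n≤1 a (b ∷ rs) len (ι-chain , last≤σa , σa<σb ∷ _) = ⊥-elim (<-irrefl refl (begin-strict
    + n                             ≡⟨ cong +_ len ⟨
    + suc (suc (length rs))         ≤⟨ +≤+ (s≤s (ℕ.m≤n+m (suc (length rs)) (toℕ a))) ⟩
    ι a + + length (b ∷ rs)         ≤⟨ linked<⇒x+length≤lastℤ ι (b ∷ rs) ι-chain ⟩
    lastℤ (ι a) (map ι (b ∷ rs))    ≤⟨ last≤σa ⟩
    app σ a                         <⟨ σa<σb ⟩
    app σ b                         ≤⟨ app≤n b ⟩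
    + n                             ∎))
    where open ≤-Reasoning

  cond2⇒n≤2 : ∀ a rest → length (a ∷ rest) ≡ n → Cond2 σ a rest → n ℕ.≤ 2
  cond2⇒n≤2 _ []       len _ = subst (ℕ._≤ 2) len (s≤s z≤n)
  cond2⇒n≤2 a (b ∷ rs) len (_ ∷ ι-chain , last≤-σa , σ-chain) =
    subst (ℕ._≤ 2) len (s≤s (s≤s k≤0))
    where
    open ≤-Reasoning
    k = length rs
    1+k≤-σa : + suc k ≤ - app σ a
    1+k≤-σa = begin
      + suc k                   ≤⟨ +≤+ (s≤s (ℕ.m≤n+m k (toℕ b))) ⟩
      ι b + + k                 ≤⟨ linked<⇒x+length≤lastℤ ι rs ι-chain ⟩
      lastℤ (ι b) (map ι rs)    ≤⟨ last≤-σa ⟩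
      - app σ a                 ∎
    2[1+k]≤2+k : + suc k + + suc k ≤ + suc (suc k)
    2[1+k]≤2+k = begin
      + suc k + + suc k                   ≤⟨ +-monoˡ-≤ (+ suc k) 1+k≤-σa ⟩
      - app σ a + + length (b ∷ rs)       ≤⟨ linked<⇒x+length≤lastℤ _ (b ∷ rs) σ-chain ⟩
      lastℤ (app σ b) (map (app σ) rs)    ≤⟨ lastℤ-map⁺ (_≤ + n) (app σ) app≤n b rs ⟩
      + n                                 ≡⟨ cong +_ len ⟨
      + suc (suc k)                       ∎
    k≤0 : k ℕ.≤ 0
    k≤0 = ℕ.+-cancelʳ-≤ (suc k) k 0 (ℕ.s≤s⁻¹ (drop‿+≤+ 2[1+k]≤2+k))

  cond3⇒allNegative : ∀ a rest → length (a ∷ rest) ≡ n → Cond3 σ a rest → σ ≡ allNegative n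
  cond3⇒allNegative a rest len (σ-chain , σa<last , ι-chain) = begin
    σ                       ≡⟨ tabulate∘lookup σ ⟨
    Vec.tabulate (app σ)    ≡⟨ tabulate-cong (λ i → map-≡⇒∈⇒≡ σ-on-L (toℕ≡downFrom⇒∈ toℕ-on-L i)) ⟩
    allNegative n           ∎
    where
    open ≡-Reasoning
    r = length rest
    L = a ∷ rest
    ι-tight : map ι L ≡ map (λ m → + suc m) (downFrom (suc r))
    ι-tight = linked>-squeezed⇒downFrom (+ 1) ι rest ι-chain (lastℤ-map⁺ (+ 1 ≤_) ι ι≥1 a rest)
                (+≤+ (s≤s (ℕ.s≤s⁻¹ (subst (toℕ a ℕ.<_) (sym len) (toℕ<n a)))))
    toℕ-on-L : map toℕ L ≡ downFrom n
    toℕ-on-L = trans (map-injective (λ { refl → refl }) (trans (sym (map-∘ L)) ι-tight)) (cong downFrom len)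
    σa≤-1 : app σ a ≤ -1ℤ
    σa≤-1 = i<1⇒1≤∣i∣⇒i≤-1 (subst (app σ a <_) (lastℤ-downFrom _ r ι-tight) σa<last) (proj₁ (proj₁ σ∈B a))
    -n+r≡-1 : - + n + + r ≡ -1ℤ
    -n+r≡-1 = trans (-m+n≡n⊖m n r) (trans (cong (r ⊖_) (sym len)) (m⊖1+m≡-1 r))
    σ-tight : map (app σ) L ≡ map (λ m → - + n + + m) (downFrom (suc r))
    σ-tight = linked>-squeezed⇒downFrom (- + n) (app σ) rest σ-chain
                (lastℤ-map⁺ (- + n ≤_) (app σ) app≥-n a rest) (≤-trans σa≤-1 (≤-reflexive (sym -n+r≡-1)))
    σ-on-L : map (app σ) L ≡ map ((_⊖ n) ∘ toℕ) L
    σ-on-L = begin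
      map (app σ) L                                ≡⟨ σ-tight ⟩
      map (λ m → - + n + + m) (downFrom (suc r))   ≡⟨ map-cong (-m+n≡n⊖m n) _ ⟩
      map (_⊖ n) (downFrom (suc r))                ≡⟨ cong (map (_⊖ n) ∘ downFrom) len ⟩
      map (_⊖ n) (downFrom n)                      ≡⟨ cong (map (_⊖ n)) toℕ-on-L ⟨
      map (_⊖ n) (map toℕ L)                       ≡⟨ map-∘ L ⟨
      map ((_⊖ n) ∘ toℕ) L                         ∎

crossing⇒allNegative : ∀ {n} → 2 ℕ.< n → (σ : Vec ℤ n) → InB n σ → HasCrossing n n σ →
                       σ ≡ allNegative n
crossing⇒allNegative 2<n σ σ∈B (a , rest , _ , len , inj₁ c₁) =
  contradiction (ℕ.≤-trans (cond1⇒n≤1 σ σ∈B a rest len c₁) (s≤s z≤n)) (ℕ.<⇒≱ 2<n)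
crossing⇒allNegative 2<n σ σ∈B (a , rest , _ , len , inj₂ (inj₁ c₂)) =
  contradiction (cond2⇒n≤2 σ σ∈B a rest len c₂) (ℕ.<⇒≱ 2<n)
crossing⇒allNegative _   σ σ∈B (a , rest , _ , len , inj₂ (inj₂ c₃)) =
  cond3⇒allNegative σ σ∈B a rest len c₃

exceptional₁ : Vec ℤ 1
exceptional₁ = + 1 ∷ []

exceptional₂ : Vec ℤ 2
exceptional₂ = + 2 ∷ -1ℤ ∷ []

exceptional₁-crossing : InB 1 exceptional₁ × HasCrossing 1 1 exceptional₁
exceptional₁-crossing =
  ((λ { Fin.zero → ℕ.≤-refl , ℕ.≤-refl }) , λ { Fin.zero → Fin.zero , refl }) ,
  Fin.zero , [] , [] ∷ [] , refl , inj₁ ([-] , ≤-refl , [-])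

exceptional₂-crossing : InB 2 exceptional₂ × HasCrossing 2 2 exceptional₂
exceptional₂-crossing =
  ( (λ { Fin.zero → s≤s z≤n , ℕ.≤-refl ; (Fin.suc Fin.zero) → ℕ.≤-refl , s≤s z≤n })
  , λ { Fin.zero → Fin.suc Fin.zero , refl ; (Fin.suc Fin.zero) → Fin.zero , refl }) ,
  Fin.suc Fin.zero , Fin.zero ∷ [] , ((λ ()) ∷ []) ∷ [] ∷ [] , refl ,
  inj₂ (inj₁ (-<+ ∷ [-] , ≤-refl , +<+ (s≤s (s≤s z≤n)) ∷ [-]))

∣i∣≡1⇒i≡±1 : ∀ {i} → ∣ i ∣ ≡ 1 → i ≡ + 1 ⊎ i ≡ -1ℤ
∣i∣≡1⇒i≡±1 {+ _}      refl = inj₁ refl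
∣i∣≡1⇒i≡±1 { -[1+ _ ]} refl = inj₂ refl

B₁-elements : (σ : Vec ℤ 1) → InB 1 σ → σ ≡ exceptional₁ ⊎ σ ≡ allNegative 1
B₁-elements (x ∷ []) (bounds , _) with 1≤∣x∣ , ∣x∣≤1 ← bounds Fin.zero =
  Sum.map (cong (_∷ [])) (cong (_∷ [])) (∣i∣≡1⇒i≡±1 (ℕ.≤-antisym ∣x∣≤1 1≤∣x∣))

cond2⇒exceptional₂ : (σ : Vec ℤ 2) → InB 2 σ → ∀ a b → a ≢ b → Cond2 σ a (b ∷ []) →
                     σ ≡ exceptional₂
cond2⇒exceptional₂ σ σ∈B Fin.zero Fin.zero a≢b _ = contradiction refl a≢b
cond2⇒exceptional₂ σ σ∈B (Fin.suc Fin.zero) (Fin.suc Fin.zero) a≢b _ = contradiction refl a≢b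
cond2⇒exceptional₂ (y ∷ z ∷ []) σ∈B Fin.zero (Fin.suc Fin.zero) _ (_ , 2≤-y , -y<z ∷ [-]) =
  ⊥-elim (<-irrefl refl (begin-strict
    + 2     ≤⟨ 2≤-y ⟩
    - y     <⟨ -y<z ⟩
    z       ≤⟨ app≤n (y ∷ z ∷ []) σ∈B (Fin.suc Fin.zero) ⟩
    + 2     ∎))
  where open ≤-Reasoning
cond2⇒exceptional₂ (y ∷ z ∷ []) σ∈B (Fin.suc Fin.zero) Fin.zero _ (_ , 1≤-z , -z<y ∷ [-]) =
  cong₂ (λ y z → y ∷ z ∷ []) y≡2 z≡-1
  where
  y≤2 : y ≤ + 2
  y≤2 = app≤n (y ∷ z ∷ []) σ∈B Fin.zero
  -z≡1 : - z ≡ + 1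
  -z≡1 = ≤-antisym (i<suc[j]⇒i≤j (<-≤-trans -z<y y≤2)) 1≤-z
  y≡2 : y ≡ + 2
  y≡2 = ≤-antisym y≤2 (subst (λ w → sucℤ w ≤ y) -z≡1 (i<j⇒suc[i]≤j -z<y))
  z≡-1 : z ≡ -1ℤ
  z≡-1 = trans (sym (neg-involutive z)) (cong -_ -z≡1)

crossing₂⇒exceptional₂⊎allNegative : (σ : Vec ℤ 2) → InB 2 σ → HasCrossing 2 2 σ →
                                     σ ≡ exceptional₂ ⊎ σ ≡ allNegative 2
crossing₂⇒exceptional₂⊎allNegative σ σ∈B (a , rest , _ , len , inj₁ c₁) =
  contradiction (cond1⇒n≤1 σ σ∈B a rest len c₁) λ { (s≤s ()) }
crossing₂⇒exceptional₂⊎allNegative σ σ∈B (a , b ∷ [] , (a≢b ∷ []) ∷ _ , _ , inj₂ (inj₁ c₂)) =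
  inj₁ (cond2⇒exceptional₂ σ σ∈B a b a≢b c₂)
crossing₂⇒exceptional₂⊎allNegative σ σ∈B (_ , [] , _ , () , inj₂ (inj₁ _))
crossing₂⇒exceptional₂⊎allNegative σ σ∈B (_ , _ ∷ _ ∷ _ , _ , () , inj₂ (inj₁ _))
crossing₂⇒exceptional₂⊎allNegative σ σ∈B (a , rest , _ , len , inj₂ (inj₂ c₃)) =
  inj₂ (cond3⇒allNegative σ σ∈B a rest len c₃)

HasCount-singleton : {P : A → Set} (w : A) → P w → (∀ x → P x → x ≡ w) → HasCount P 1
HasCount-singleton w Pw complete =
  w ∷ [] , [] ∷ [] , (λ x → mk⇔ (λ { (here refl) → Pw }) (here ∘ complete x)) , refl

HasCount-pair : {P : A → Set} {v w : A} → v ≢ w → P v → P w →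
                (∀ x → P x → x ≡ v ⊎ x ≡ w) → HasCount P 2
HasCount-pair v≢w Pv Pw complete =
  _ ∷ _ ∷ [] , (v≢w ∷ []) ∷ [] ∷ [] ,
  (λ x → mk⇔ (λ { (here refl) → Pv ; (there (here refl)) → Pw })
              ([ here , there ∘ here ]′ ∘ complete x)) ,
  refl

allNegative-crossing-perm : ∀ r →
                            InB (suc r) (allNegative (suc r)) × HasCrossing (suc r) (suc r) (allNegative (suc r))
allNegative-crossing-perm r = allNegative-∈B (suc r) , allNegative-crossing r

corollary4p2 : (n : ℕ) → 1 ℕ.≤ n → (n ℕ.≤ 2 → CB≡ n 2) × (2 ℕ.< n → CB≡ n 1)
corollary4p2 1 _ =
  (λ _ → HasCount-pair (λ ()) exceptional₁-crossing (allNegative-crossing-perm 0)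
                       (λ σ → B₁-elements σ ∘ proj₁)) ,
  λ { (s≤s ()) }
corollary4p2 2 _ =
  (λ _ → HasCount-pair (λ ()) exceptional₂-crossing (allNegative-crossing-perm 1)
                       (uncurry ∘ crossing₂⇒exceptional₂⊎allNegative)) ,
  λ { (s≤s (s≤s ())) }
corollary4p2 n@(suc (suc (suc r))) _ =
  (λ { (s≤s (s≤s ())) }) ,
  λ 2<n → HasCount-singleton (allNegative n) (allNegative-crossing-perm (suc (suc r)))
                             (uncurry ∘ crossing⇒allNegative 2<n)
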